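{- Let $\pi : F^{\ast} \to T$ be a partial probability function (on the Kleene language with $m$ sentential variables). Then: (1) $\pi(\mathrm{n}) = (0,0)$; (2) if $\alpha \models 0$ then $\pi(\alpha) = (0,1)$; (3) if $\alpha \models \mathrm{n}$ then $\pi(\alpha) \preccurlyeq (0,0)$; (4) for every formula $\alpha$, $\pi(\alpha) = \pi(\alpha \vee \mathrm{n}) + \pi(\alpha \wedge \mathrm{n})$ (addition in $\mathbb{R}^2$ componentwise).
   Context: Kleene logic: $F^{\ast}$ is the set of formulas built from sentential variables $p_1,\dots,p_m$, the constants $0$, $1$, $\mathrm{n}$ and the connectives $\neg,\wedge,\vee$. The truth values are $\{0,\mathrm{n},1\}$, totally ordered by $0<\mathrm{n}<1$, with $x\wedge y=\min(x,y)$, $x\vee y=\max(x,y)$, $\neg 0=1$, $\neg 1=0$, $\neg \mathrm{n}=\mathrm{n}$. A world is $w\in\{0,\mathrm{n},1\}^m$; $V_w(p_i)=w_i$, the constants are interpreted as themselves, and $V_w$ extends homomorphically to all formulas. Logical consequence: $\alpha\models\beta$ iff $V_w(\alpha)\le V_w(\beta)$ for all worlds $w$ (in particular $1\models\alpha$ means $\alpha$ is true in every world, $\mathrm{n}\models\alpha$ means $V_w(\alpha)\in\{\mathrm{n},1\}$ for all $w$, $\alpha\models 0$ means $\alpha$ is false in every world, $\alpha\models\mathrm{n}$ means $V_w(\alpha)\in\{0,\mathrm{n}\}$ for all $w$). On $\mathbb{R}^2$: $(x,y)\preccurlyeq(w,z)$ iff $x\le w$ and $z\le y$; addition, subtraction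 and multiplication are componentwise. $T=\{(x,y)\in[0,1]^2: x+y\le 1\}$ and $\sigma(x,y)=(y,x)$. A partial probability function is a map $\pi:F^{\ast}\to T$ such that for all formulas $\alpha,\beta$: (A1) $1\models\alpha$ implies $\pi(\alpha)=(1,0)$; (A2) $\pi(\alpha\vee\beta)=\pi(\alpha)+\pi(\beta)-\pi(\alpha\wedge\beta)$; (A3) $\pi(\neg\alpha)=\sigma(\pi(\alpha))$; (A4) $\mathrm{n}\models\alpha$ implies $(0,0)\preccurlyeq\pi(\alpha)$. -}

module Defs where

open import Level using (0ℓ)
open import Data.Nat using (ℕ)
open import Data.Fin using (Fin)
open import Data.Product using (_×_; _,_; Σ; ∃; proj₁; proj₂)
open import Relation.Binary.PropositionalEquality using (_≡_; _≢_)
open import Relation.Binary.Structures using (IsTotalOrder)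
open import Algebra.Structures using (IsCommutativeRing)

-- The real numbers, axiomatised as a complete ordered field
-- (any two models are isomorphic, so quantifying over all models is
-- the same as speaking about ℝ).

record CompleteOrderedField : Set₁ where
  infixl 6 _+_
  infixl 7 _*_
  infix  4 _≤_
  field
    Carrier : Set
    _+_ _*_ : Carrier → Carrier → Carrier
    -_      : Carrier → Carrier
    0r 1r   : Carrier
    _≤_     : Carrier → Carrier → Set
    isCommutativeRing : IsCommutativeRing _≡_ _+_ _*_ -_ 0r 1r
    0≢1     : 0r ≢ 1r
    inverse : ∀ x → x ≢ 0r → ∃ λ y → x * y ≡ 1r
    isTotalOrder : IsTotalOrder _≡_ _≤_
    +-mono-≤ : ∀ {x y} z → x ≤ y → x + z ≤ y + z
    *-nonneg : ∀ {x y} → 0r ≤ x → 0r ≤ y → 0r ≤ x * y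
    completeness : (P : Carrier → Set) → ∃ P → (∃ λ b → ∀ x → P x → x ≤ b) →
                   ∃ λ s → (∀ x → P x → x ≤ s) × (∀ b → (∀ x → P x → x ≤ b) → s ≤ b)

data K3 : Set where
  f0 fn f1 : K3

data _≤K_ : K3 → K3 → Set where
  0≤ : ∀ {x} → f0 ≤K x
  n≤n : fn ≤K fn
  n≤1 : fn ≤K f1
  1≤1 : f1 ≤K f1

minK maxK : K3 → K3 → K3
minK f0 y = f0
minK fn f0 = f0
minK fn fn = fn
minK fn f1 = fn
minK f1 y = y
maxK f0 y = y
maxK fn f0 = fn
maxK fn fn = fn
maxK fn f1 = f1
maxK f1 y = f1

negK : K3 → K3
negK f0 = f1
negK fn = fn
negK f1 = f0

data Formula (m : ℕ) : Set where
  var  : Fin m → Formula m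
  ⊥c nc ⊤c : Formula m
  ¬f_  : Formula m → Formula m
  _∧f_ _∨f_ : Formula m → Formula m → Formula m

World : ℕ → Set
World m = Fin m → K3

V : ∀ {m} → World m → Formula m → K3
V w (var i) = w i
V w ⊥c = f0
V w nc = fn
V w ⊤c = f1
V w (¬f a) = negK (V w a)
V w (a ∧f b) = minK (V w a) (V w b)
V w (a ∨f b) = maxK (V w a) (V w b)

_⊨_ : ∀ {m} → Formula m → Formula m → Set
_⊨_ {m} a b = (w : World m) → V w a ≤K V w b

module _ (R : CompleteOrderedField) where
  open CompleteOrderedField R

  R² : Set
  R² = Carrier × Carrier

  _≼_ : R² → R² → Set
  (x , y) ≼ (w , z) = (x ≤ w) × (z ≤ y)

  _+²_ _-²_ : R² → R² → R²
  (x , y) +² (w , z) = (x + w , y + z)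
  (x , y) -² (w , z) = (x + (- w) , y + (- z))

  σ : R² → R²
  σ (x , y) = (y , x)

  InT : R² → Set
  InT (x , y) = (0r ≤ x) × (x ≤ 1r) × (0r ≤ y) × (y ≤ 1r) × (x + y ≤ 1r)

  record IsPartialProbability (m : ℕ) (π : Formula m → R²) : Set where
    field
      intoT : ∀ α → InT (π α)
      A1 : ∀ α → ⊤c ⊨ α → π α ≡ (1r , 0r)
      A2 : ∀ α β → π (α ∨f β) ≡ (π α +² π β) -² π (α ∧f β)
      A3 : ∀ α → π (¬f α) ≡ σ (π α)
      A4 : ∀ α → nc ⊨ α → (0r , 0r) ≼ π α

-- Negation swaps the two coordinates of π and reverses ⊨, so α ⊨ 0 turns into 1 ⊨ ¬α (axiom A1)
-- and α ⊨ n into n ⊨ ¬α (axiom A4); the latter says π α ≼ (0,0).  Since n ⊨ n, both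
-- (0,0) ≼ π n and π n ≼ (0,0) hold, whence π n = (0,0); inclusion–exclusion (A2) for α ∨ n
-- then reads π (α ∨ n) = π α − π (α ∧ n).
module Submission where

open import Defs
open import Data.Nat using (ℕ)
open import Data.Product using (_×_; _,_; swap)
open import Relation.Binary.PropositionalEquality
  using (_≡_; sym; trans; cong; cong₂; subst; module ≡-Reasoning)
open import Relation.Binary.Structures using (IsTotalOrder)
open import Algebra.Structures using (IsCommutativeRing)
open CompleteOrderedField using (0r; 1r)

≤K-refl : ∀ {x} → x ≤K x
≤K-refl {f0} = 0≤
≤K-refl {fn} = n≤n
≤K-refl {f1} = 1≤1

≤K-trans : ∀ {x y z} → x ≤K y → y ≤K z → x ≤K z
≤K-trans 0≤  _   = 0≤
≤K-trans n≤n q   = q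
≤K-trans n≤1 1≤1 = n≤1
≤K-trans 1≤1 1≤1 = 1≤1

negK-antitone : ∀ {x y} → x ≤K y → negK y ≤K negK x
negK-antitone {y = f0} 0≤ = 1≤1
negK-antitone {y = fn} 0≤ = n≤1
negK-antitone {y = f1} 0≤ = 0≤
negK-antitone n≤n = n≤n
negK-antitone n≤1 = 0≤
negK-antitone 1≤1 = 0≤

module _ {m : ℕ} where

  ⊨-refl : ∀ (α : Formula m) → α ⊨ α
  ⊨-refl _ _ = ≤K-refl

  ⊨-trans : ∀ (α β γ : Formula m) → α ⊨ β → β ⊨ γ → α ⊨ γ
  ⊨-trans _ _ _ α⊨β β⊨γ w = ≤K-trans (α⊨β w) (β⊨γ w)

  ¬f-antitone : ∀ (α β : Formula m) → α ⊨ β → (¬f β) ⊨ (¬f α)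
  ¬f-antitone _ _ α⊨β w = negK-antitone (α⊨β w)

  ⊨⊥c⇒⊤c⊨¬f : ∀ (α : Formula m) → α ⊨ ⊥c → ⊤c ⊨ (¬f α)
  ⊨⊥c⇒⊤c⊨¬f α α⊨⊥ = ⊨-trans ⊤c (¬f ⊥c) (¬f α) (λ _ → 1≤1) (¬f-antitone α ⊥c α⊨⊥)

  ⊨nc⇒nc⊨¬f : ∀ (α : Formula m) → α ⊨ nc → nc ⊨ (¬f α)
  ⊨nc⇒nc⊨¬f α α⊨n = ⊨-trans nc (¬f nc) (¬f α) (λ _ → n≤n) (¬f-antitone α nc α⊨n)

module Plane (R : CompleteOrderedField) where
  open CompleteOrderedField R hiding (0r; 1r)
  open IsCommutativeRing isCommutativeRing using (+-assoc; +-identityʳ; -‿inverseˡ)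

  0² : R² R
  0² = (0r R , 0r R)

  ≼-antisym : ∀ {p q} → _≼_ R p q → _≼_ R q p → p ≡ q
  ≼-antisym (x≤w , z≤y) (w≤x , y≤z) =
    cong₂ _,_ (IsTotalOrder.antisym isTotalOrder x≤w w≤x)
              (IsTotalOrder.antisym isTotalOrder y≤z z≤y)

  0≼σ⇒≼0 : ∀ {p} → _≼_ R 0² (σ R p) → _≼_ R p 0²
  0≼σ⇒≼0 = swap

  +²-identityʳ : ∀ p → _+²_ R p 0² ≡ p
  +²-identityʳ (x , y) = cong₂ _,_ (+-identityʳ x) (+-identityʳ y)

  -²-+²-cancel : ∀ p q → _+²_ R (_-²_ R p q) q ≡ p
  -²-+²-cancel (x , y) (w , z) = cong₂ _,_ (cancel x w) (cancel y z)
    where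
      cancel : ∀ a b → a + - b + b ≡ a
      cancel a b = trans (+-assoc a (- b) b) (trans (cong (a +_) (-‿inverseˡ b)) (+-identityʳ a))

module PartialProbability (R : CompleteOrderedField) {m : ℕ} {π : Formula m → R² R}
                          (isPP : IsPartialProbability R m π) where
  open IsPartialProbability isPP
  open Plane R

  ⊨⊥c⇒π≡01 : ∀ α → α ⊨ ⊥c → π α ≡ (0r R , 1r R)
  ⊨⊥c⇒π≡01 α α⊨⊥ = cong (σ R) (trans (sym (A3 α)) (A1 (¬f α) (⊨⊥c⇒⊤c⊨¬f α α⊨⊥)))

  ⊨nc⇒π≼0 : ∀ α → α ⊨ nc → _≼_ R (π α) 0²
  ⊨nc⇒π≼0 α α⊨n = 0≼σ⇒≼0 (subst (_≼_ R 0²) (A3 α) (A4 (¬f α) (⊨nc⇒nc⊨¬f α α⊨n)))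

  π-nc : π nc ≡ 0²
  π-nc = ≼-antisym (⊨nc⇒π≼0 nc (⊨-refl nc)) (A4 nc (⊨-refl nc))

  π≡π∨nc+π∧nc : ∀ α → π α ≡ _+²_ R (π (α ∨f nc)) (π (α ∧f nc))
  π≡π∨nc+π∧nc α = sym (begin
    _+²_ R (π (α ∨f nc)) (π (α ∧f nc))
      ≡⟨ cong (λ p → _+²_ R p (π (α ∧f nc))) (A2 α nc) ⟩
    _+²_ R (_-²_ R (_+²_ R (π α) (π nc)) (π (α ∧f nc))) (π (α ∧f nc))
      ≡⟨ -²-+²-cancel _ _ ⟩
    _+²_ R (π α) (π nc)
      ≡⟨ cong (_+²_ R (π α)) π-nc ⟩
    _+²_ R (π α) 0²
      ≡⟨ +²-identityʳ (π α) ⟩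
    π α ∎)
    where open ≡-Reasoning

mainTheorem1 : (R : CompleteOrderedField) (m : ℕ) (π : Formula m → R² R) →
    IsPartialProbability R m π →
    (π nc ≡ (0r R , 0r R))
    × (∀ α → α ⊨ ⊥c → π α ≡ (0r R , 1r R))
    × (∀ α → α ⊨ nc → _≼_ R (π α) (0r R , 0r R))
    × (∀ α → π α ≡ _+²_ R (π (α ∨f nc)) (π (α ∧f nc)))
mainTheorem1 R m π isPP = π-nc , ⊨⊥c⇒π≡01 , ⊨nc⇒π≼0 , π≡π∨nc+π∧nc
  where open PartialProbability R isPP
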